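{- For every $n\ge 0$, $f(n)=f^{1P}(n)$, where $f$ is defined by $f(0)=0$, $f(n)=f(n-1)+1+\frac1n\sum_{i=0}^{n-1}f(i)$ for $n>0$, and $f^{1P}(n)$ is the expected value of $f^{1P}([n],\sigma)$ when $\sigma$ is a uniformly random permutation of $[n]$.
   Context: For a finite set $N\subseteq[n]$ and an injective map $\sigma$ from $[n]$ (or a superset of $N$) to $\mathbb{N}$, define $f^{1P}(\emptyset,\sigma)=0$ and, for $N\neq\emptyset$, $f^{1P}(N,\sigma)=f^{1P}(N\setminus\{i\},\sigma)+1+f^{1P}(N\cap[i-1],\sigma)$ where $i\in N$ minimizes $\sigma(i)$ over $N$. This is the number of times the one-permutation randomized counter $\textsc{RandCount}^{1P}(N,\sigma)$ sets a bit to $1$. Here $[m]=\{1,\dots,m\}$ and $[0]=\emptyset$. -}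

module Defs where

open import Data.Bool using (Bool; true; false; _∧_; not; if_then_else_)
open import Data.Nat using (ℕ; zero; suc; _+_; _∸_; _≡ᵇ_; _<ᵇ_)
open import Data.List using (List; []; _∷_; length; map; concatMap; filterᵇ; foldr; upTo)
open import Data.Nat.ListAction using (sum)
open import Data.Integer using (+_)
open import Data.Rational using (ℚ; 0ℚ; 1ℚ; _/_) renaming (_+_ to _+ℚ_; _*_ to _*ℚ_)

sumℚ : List ℚ → ℚ
sumℚ = foldr _+ℚ_ 0ℚ

mutual
  f : ℕ → ℚ
  f zero    = 0ℚ
  f (suc n) = f n +ℚ 1ℚ +ℚ ((+ 1 / suc n) *ℚ sumℚ (fs (suc n)))

  fs : ℕ → List ℚ
  fs zero    = []
  fs (suc n) = f n ∷ fs n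

-- f^{1P}(N, σ).  N is a finite set of naturals given as a duplicate-free
-- list; σ : ℕ → ℕ (injective on N).

argminσ : (ℕ → ℕ) → ℕ → List ℕ → ℕ
argminσ σ x []       = x
argminσ σ x (y ∷ ys) = if σ y <ᵇ σ x then argminσ σ y ys else argminσ σ x ys

removeℕ : ℕ → List ℕ → List ℕ
removeℕ i = filterᵇ (λ x → not (x ≡ᵇ i))

belowℕ : ℕ → List ℕ → List ℕ
belowℕ i = filterᵇ (λ x → x <ᵇ i)

-- fuel-driven version; fuel = |N| always suffices since both recursive
-- calls are on strictly smaller sets
f1P-fuel : ℕ → List ℕ → (ℕ → ℕ) → ℕ
f1P-fuel _        []       σ = 0
f1P-fuel zero     (_ ∷ _)  σ = 0
f1P-fuel (suc k) (x ∷ xs) σ =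
  let i = argminσ σ x xs ; N = x ∷ xs in
  f1P-fuel k (removeℕ i N) σ + 1 + f1P-fuel k (belowℕ i N) σ

f1P : List ℕ → (ℕ → ℕ) → ℕ
f1P N σ = f1P-fuel (length N) N σ

range : ℕ → List ℕ
range n = map suc (upTo n)

allWords : ℕ → ℕ → List (List ℕ)
allWords n zero    = [] ∷ []
allWords n (suc m) = concatMap (λ a → map (a ∷_) (allWords n m)) (range n)

memberᵇ : ℕ → List ℕ → Bool
memberᵇ x []       = false
memberᵇ x (y ∷ ys) = (x ≡ᵇ y) Data.Bool.∨ memberᵇ x ys

distinctᵇ : List ℕ → Bool
distinctᵇ []       = true
distinctᵇ (x ∷ xs) = not (memberᵇ x xs) ∧ distinctᵇ xs

-- all permutations σ of [n], as the word σ(1) σ(2) … σ(n)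
perms : ℕ → List (List ℕ)
perms n = filterᵇ distinctᵇ (allWords n n)

-- the map i ↦ σ(i) encoded by a word (σ(i) = (i-1)-th letter;
-- values outside [n] are irrelevant)
nth : List ℕ → ℕ → ℕ
nth []       _       = 0
nth (x ∷ xs) zero    = x
nth (x ∷ xs) (suc k) = nth xs k

asMap : List ℕ → ℕ → ℕ
asMap w i = nth w (i ∸ 1)

totalf1P : ℕ → ℕ
totalf1P n = sum (map (λ w → f1P (range n) (asMap w)) (perms n))

toℚ : ℕ → ℚ
toℚ k = + k / 1

-- Read σ on [n] as the word w = σ(1) … σ(n). The counter only compares σ-values, so f1P([n], σ) is a
-- function f1Pʷ of w alone: if w = U m V with m its leftmost minimum, then f1Pʷ w = f1Pʷ (U V) + 1 + f1Pʷ U.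
-- We prove more: summed over all arrangements w of c distinct numbers, f1Pʷ of the length-k prefix of w
-- totals f(k)·c! for every k ≤ c. The arrangements of x ∷ xs, with x the smallest, arise by inserting x at a
-- position j into an arrangement of xs. The length-(k+1) prefix of the result is the length-k prefix with x
-- inserted at j if j ≤ k, which costs f1Pʷ(prefix k) + 1 + f1Pʷ(prefix j), and is the old length-(k+1) prefix
-- if j > k. By induction the total is c!·((k+1)(f(k)+1) + Σ_{j≤k} f(j) + (c−k) f(k+1)), which equals
-- (c+1)!·f(k+1) because (k+1) f(k+1) = (k+1)(f(k)+1) + Σ_{j≤k} f(j).

module Submission where

open import Defs
open import Algebra.Properties.CommutativeSemigroup using (interchange)
open import Data.Bool using (Bool; true; false; T; not; _∧_; if_then_else_)
open import Data.Empty using (⊥-elim)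
import Data.Integer as ℤ
import Data.Integer.Properties as ℤ
open import Data.List using (List; []; _∷_; _++_; length; map; concatMap; filter; filterᵇ; take; drop; upTo; applyUpTo)
open import Data.List.Membership.Propositional using (_∈_; _∉_)
open import Data.List.Membership.Propositional.Properties using (∈-filter⁻; ∈-++⁺ʳ)
open import Data.List.Properties
  using (map-++; map-∘; map-cong; map-cong-local; map-upTo; length-map; length-++; length-upTo; ++-identityʳ; ++-conicalʳ;
         ∷-injectiveˡ; ∷-injectiveʳ; concatMap-cong; take-all; take-take; take++drop≡id;
         filter-++; filter-accept; filter-reject; filter-all; filter-none; filter-notAll)
open import Data.List.Relation.Unary.All as All using (All; []; _∷_)
import Data.List.Relation.Unary.All.Properties as All
open import Data.List.Relation.Unary.AllPairs using (AllPairs; []; _∷_)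
import Data.List.Relation.Unary.AllPairs.Properties as AllPairs
import Data.List.Relation.Unary.Any as Any
open import Data.List.Relation.Unary.Any using (here)
open import Data.Nat using (ℕ; zero; suc; _+_; _*_; _∸_; _≤_; _<_; _≡ᵇ_; _<ᵇ_; z≤n; s≤s; _!)
open import Data.Nat.Coprimality as Coprime using (1-coprimeTo)
open import Data.Nat.ListAction using (sum)
open import Data.Nat.ListAction.Properties using (sum-++)
open import Data.Nat.Properties
  using (+-assoc; +-comm; +-suc; +-identityʳ; *-identityʳ; *-zeroʳ; +-commutativeSemigroup; m+[n∸m]≡n; n∸n≡0;
         ≤-refl; ≤-reflexive; ≤-trans; ≤-pred; <-irrefl; <-trans; ≤-<-trans; <⇒≤; <⇒≢; <⇒≯; ≤⇒≯; ≮⇒≥;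
         m≤m+n; m<n⇒m<1+n; m≤n⇒m<n∨m≡n; m≤n⇒m⊓n≡m; m∸n≢0⇒n<m; suc-injective; module ≤-Reasoning;
         ≡ᵇ⇒≡; ≡⇒≡ᵇ; <ᵇ⇒<; <⇒<ᵇ; <ᵇ-reflects-<)
open import Data.Product using (_×_; _,_; proj₁; proj₂)
open import Data.Rational using (ℚ; mkℚ; 1ℚ; _/_) renaming (_+_ to _+ℚ_; _*_ to _*ℚ_)
open import Data.Rational.Properties using (normalize-coprime; /-cong)
import Data.Rational.Properties as ℚ
open import Data.Rational.Solver using (module +-*-Solver)
open import Data.Sum using (inj₁; inj₂)
open import Function using (_∘_; id; case_of_)
open import Relation.Binary.PropositionalEquality
open import Relation.Nullary using (¬_; Dec; ofʸ; ofⁿ)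
open import Relation.Nullary.Decidable using (T?)
open import Relation.Unary using (Decidable)

private variable
  A B : Set

-- Both notations bind tighter than _+_: ∑[ j < n ] a + b is (∑[ j < n ] a) + b.

∑ : List A → (A → ℕ) → ℕ
∑ xs g = sum (map g xs)

syntax ∑ xs (λ x → e) = ∑[ x ∈ xs ] e

∑-cong : ∀ {g h : A → ℕ} (xs : List A) → (∀ x → g x ≡ h x) → ∑ xs g ≡ ∑ xs h
∑-cong xs g≗h = cong sum (map-cong g≗h xs)

∑-cong-local : ∀ {g h : A → ℕ} {xs} → All (λ x → g x ≡ h x) xs → ∑ xs g ≡ ∑ xs h
∑-cong-local eqs = cong sum (map-cong-local eqs)

∑-++ : ∀ xs ys (g : A → ℕ) → ∑ (xs ++ ys) g ≡ ∑ xs g + ∑ ys g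
∑-++ xs ys g = trans (cong sum (map-++ g xs ys)) (sum-++ (map g xs) (map g ys))

∑-map : ∀ (f : A → B) xs (g : B → ℕ) → ∑ (map f xs) g ≡ ∑ xs (g ∘ f)
∑-map f xs g = cong sum (sym (map-∘ xs))

∑-concatMap : ∀ (h : A → List B) xs (g : B → ℕ) → ∑ (concatMap h xs) g ≡ ∑[ x ∈ xs ] ∑ (h x) g
∑-concatMap h []       g = refl
∑-concatMap h (x ∷ xs) g = trans (∑-++ (h x) (concatMap h xs) g) (cong (∑ (h x) g +_) (∑-concatMap h xs g))

∑-+ : ∀ xs (g h : A → ℕ) → ∑[ x ∈ xs ] (g x + h x) ≡ ∑ xs g + ∑ xs h
∑-+ []       g h = refl
∑-+ (x ∷ xs) g h = trans (cong (g x + h x +_) (∑-+ xs g h)) (interchange +-commutativeSemigroup (g x) (h x) _ _)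

∑-const : ∀ (xs : List A) c → ∑[ x ∈ xs ] c ≡ length xs * c
∑-const []       c = refl
∑-const (x ∷ xs) c = cong (c +_) (∑-const xs c)

∑< : ℕ → (ℕ → ℕ) → ℕ
∑< zero    g = 0
∑< (suc n) g = g 0 + ∑< n (g ∘ suc)

syntax ∑< n (λ j → e) = ∑[ j < n ] e

∑<-cong : ∀ n {g h : ℕ → ℕ} → (∀ j → j < n → g j ≡ h j) → ∑< n g ≡ ∑< n h
∑<-cong zero    eq = refl
∑<-cong (suc n) eq = cong₂ _+_ (eq 0 (s≤s z≤n)) (∑<-cong n (λ j j<n → eq (suc j) (s≤s j<n)))

∑<-const : ∀ n c → ∑[ j < n ] c ≡ n * c
∑<-const zero    c = refl
∑<-const (suc n) c = cong (c +_) (∑<-const n c)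

∑<-+ : ∀ n (g h : ℕ → ℕ) → ∑[ j < n ] (g j + h j) ≡ ∑< n g + ∑< n h
∑<-+ zero    g h = refl
∑<-+ (suc n) g h =
  trans (cong (g 0 + h 0 +_) (∑<-+ n (g ∘ suc) (h ∘ suc))) (interchange +-commutativeSemigroup (g 0) (h 0) _ _)

∑<-split : ∀ m n g → ∑< (m + n) g ≡ ∑< m g + ∑[ j < n ] g (m + j)
∑<-split zero    n g = refl
∑<-split (suc m) n g = trans (cong (g 0 +_) (∑<-split m n (g ∘ suc))) (sym (+-assoc (g 0) _ _))

∑<-suc : ∀ n g → ∑< (suc n) g ≡ ∑< n g + g n
∑<-suc zero    g = +-comm (g 0) 0
∑<-suc (suc n) g = trans (cong (g 0 +_) (∑<-suc n (g ∘ suc))) (sym (+-assoc (g 0) _ _))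

∑-∑<-comm : ∀ (xs : List A) n (g : A → ℕ → ℕ) →
  ∑[ x ∈ xs ] ∑< n (g x) ≡ ∑[ j < n ] ∑[ x ∈ xs ] g x j
∑-∑<-comm []       n g = sym (trans (∑<-const n 0) (*-zeroʳ n))
∑-∑<-comm (x ∷ xs) n g = trans (cong (∑< n (g x) +_) (∑-∑<-comm xs n g)) (sym (∑<-+ n (g x) _))

filterᵇ-concatMap : ∀ (p : B → Bool) (h : A → List B) xs →
  filterᵇ p (concatMap h xs) ≡ concatMap (filterᵇ p ∘ h) xs
filterᵇ-concatMap p h []       = refl
filterᵇ-concatMap p h (x ∷ xs) =
  trans (filter-++ (T? ∘ p) (h x) _) (cong (filterᵇ p (h x) ++_) (filterᵇ-concatMap p h xs))

filterᵇ-map : ∀ (p : B → Bool) (f : A → B) xs → filterᵇ p (map f xs) ≡ map f (filterᵇ (p ∘ f) xs)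
filterᵇ-map p f []       = refl
filterᵇ-map p f (x ∷ xs) with p (f x)
... | true  = cong (f x ∷_) (filterᵇ-map p f xs)
... | false = filterᵇ-map p f xs

filterᵇ-∧ : ∀ (p q : A → Bool) xs → filterᵇ (λ x → p x ∧ q x) xs ≡ filterᵇ q (filterᵇ p xs)
filterᵇ-∧ p q []       = refl
filterᵇ-∧ p q (x ∷ xs) with p x
... | false = filterᵇ-∧ p q xs
... | true with q x
...   | true  = cong (x ∷_) (filterᵇ-∧ p q xs)
...   | false = filterᵇ-∧ p q xs

concatMap-filterᵇ : ∀ (p : A → Bool) (h : A → List B) xs →
  concatMap h (filterᵇ p xs) ≡ concatMap (λ x → if p x then h x else []) xs
concatMap-filterᵇ p h []       = refl
concatMap-filterᵇ p h (x ∷ xs) with p x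
... | true  = cong (h x ++_) (concatMap-filterᵇ p h xs)
... | false = concatMap-filterᵇ p h xs

≡ᵇ-comm : ∀ m n → (m ≡ᵇ n) ≡ (n ≡ᵇ m)
≡ᵇ-comm zero    zero    = refl
≡ᵇ-comm zero    (suc n) = refl
≡ᵇ-comm (suc m) zero    = refl
≡ᵇ-comm (suc m) (suc n) = ≡ᵇ-comm m n

-- removeℕ i and belowℕ i are, definitionally, filter (keep? i) and filter (below? i).

keep? : (i y : ℕ) → Dec (T (not (y ≡ᵇ i)))
keep? i y = T? (not (y ≡ᵇ i))

below? : (i y : ℕ) → Dec (T (y <ᵇ i))
below? i y = T? (y <ᵇ i)

T-not-absurd : ∀ {b} → T b → ¬ T (not b)
T-not-absurd {true} _ ()

≢⇒T-not-≡ᵇ : ∀ {y i} → y ≢ i → T (not (y ≡ᵇ i))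
≢⇒T-not-≡ᵇ {y} {i} y≢i with y ≡ᵇ i in eq
... | true  = y≢i (≡ᵇ⇒≡ y i (subst T (sym eq) _))
... | false = _

removeℕ-∷-≢ : ∀ {i y} ys → y ≢ i → removeℕ i (y ∷ ys) ≡ y ∷ removeℕ i ys
removeℕ-∷-≢ {i} ys y≢i = filter-accept (keep? i) {xs = ys} (≢⇒T-not-≡ᵇ y≢i)

removeℕ-∉ : ∀ {i ys} → i ∉ ys → removeℕ i ys ≡ ys
removeℕ-∉ {i} i∉ys =
  filter-all (keep? i) (All.tabulate λ {y} y∈ys → ≢⇒T-not-≡ᵇ {y} {i} λ { refl → i∉ys y∈ys })

removeℕ-head : ∀ {i ys} → i ∉ ys → removeℕ i (i ∷ ys) ≡ ys
removeℕ-head {i} {ys} i∉ys =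
  trans (filter-reject (keep? i) {x = i} {xs = ys} (T-not-absurd (≡⇒≡ᵇ i i refl))) (removeℕ-∉ i∉ys)

∈-removeℕ⁻ : ∀ {i y} ys → y ∈ removeℕ i ys → y ∈ ys
∈-removeℕ⁻ {i} ys y∈ = proj₁ (∈-filter⁻ (keep? i) {xs = ys} y∈)

length-removeℕ-< : ∀ {i ys} → i ∈ ys → length (removeℕ i ys) < length ys
length-removeℕ-< {i} {ys} i∈ys =
  filter-notAll (keep? i) ys (Any.map (λ { refl → T-not-absurd (≡⇒≡ᵇ i i refl) }) i∈ys)

All-<⇒∉ : ∀ {x xs} → All (x <_) xs → x ∉ xs
All-<⇒∉ x<xs x∈xs = <-irrefl refl (All.lookup x<xs x∈xs)

AllPairs-around : ∀ U {i V} → AllPairs _<_ (U ++ i ∷ V) → All (_< i) U × All (i <_) V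
AllPairs-around []      (i<V ∷ _)      = [] , i<V
AllPairs-around (u ∷ U) (u<rest ∷ rest) =
  All.lookup u<rest (∈-++⁺ʳ U (here refl)) ∷ proj₁ (AllPairs-around U rest) , proj₂ (AllPairs-around U rest)

removeℕ-around : ∀ U {i} V → All (_< i) U → All (i <_) V → removeℕ i (U ++ i ∷ V) ≡ U ++ V
removeℕ-around U {i} V U<i i<V = begin
  removeℕ i (U ++ i ∷ V)          ≡⟨ filter-++ (keep? i) U (i ∷ V) ⟩
  removeℕ i U ++ removeℕ i (i ∷ V) ≡⟨ cong₂ _++_ (filter-all (keep? i) (All.map (≢⇒T-not-≡ᵇ ∘ <⇒≢) U<i))
                                                 (removeℕ-head (All-<⇒∉ i<V)) ⟩
  U ++ V                           ∎
  where open ≡-Reasoning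

belowℕ-around : ∀ U {i} V → All (_< i) U → All (i <_) V → belowℕ i (U ++ i ∷ V) ≡ U
belowℕ-around U {i} V U<i i<V = begin
  belowℕ i (U ++ i ∷ V)             ≡⟨ filter-++ (below? i) U (i ∷ V) ⟩
  belowℕ i U ++ belowℕ i (i ∷ V)    ≡⟨ cong₂ _++_ (filter-all (below? i) (All.map <⇒<ᵇ U<i))
                                         (trans (filter-reject (below? i) {x = i} {xs = V} (<-irrefl refl ∘ <ᵇ⇒< i i))
                                                (filter-none (below? i) (All.map (λ {v} i<v → <⇒≯ i<v ∘ <ᵇ⇒< v i) i<V))) ⟩
  U ++ []                           ≡⟨ ++-identityʳ U ⟩
  U                                 ∎
  where open ≡-Reasoning

-- Arrangements

words : List ℕ → ℕ → List (List ℕ)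
words A zero    = [] ∷ []
words A (suc m) = concatMap (λ a → map (a ∷_) (words A m)) A

arrangements : List ℕ → ℕ → List (List ℕ)
arrangements A zero    = [] ∷ []
arrangements A (suc m) = concatMap (λ a → map (a ∷_) (arrangements (removeℕ a A) m)) A

allWords≡words : ∀ n m → allWords n m ≡ words (range n) m
allWords≡words n zero    = refl
allWords≡words n (suc m) = cong (λ W → concatMap (λ a → map (a ∷_) W) (range n)) (allWords≡words n m)

words-avoiding : ∀ a A m → filterᵇ (not ∘ memberᵇ a) (words A m) ≡ words (removeℕ a A) m
words-avoiding a A zero    = refl
words-avoiding a A (suc m) = begin
  filterᵇ (not ∘ memberᵇ a) (concatMap (λ b → map (b ∷_) (words A m)) A)
    ≡⟨ filterᵇ-concatMap _ _ A ⟩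
  concatMap (λ b → filterᵇ (not ∘ memberᵇ a) (map (b ∷_) (words A m))) A
    ≡⟨ concatMap-cong avoid A ⟩
  concatMap (λ b → if not (b ≡ᵇ a) then map (b ∷_) (words (removeℕ a A) m) else []) A
    ≡⟨ concatMap-filterᵇ _ _ A ⟨
  concatMap (λ b → map (b ∷_) (words (removeℕ a A) m)) (removeℕ a A) ∎
  where
  open ≡-Reasoning
  avoid : ∀ b → filterᵇ (not ∘ memberᵇ a) (map (b ∷_) (words A m))
              ≡ (if not (b ≡ᵇ a) then map (b ∷_) (words (removeℕ a A) m) else [])
  avoid b rewrite filterᵇ-map (not ∘ memberᵇ a) (b ∷_) (words A m) | ≡ᵇ-comm b a with a ≡ᵇ b
  ... | true  = cong (map (b ∷_)) (filter-none _ (All.universal (λ _ ()) (words A m)))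
  ... | false = cong (map (b ∷_)) (words-avoiding a A m)

filter-distinct-words : ∀ A m → filterᵇ distinctᵇ (words A m) ≡ arrangements A m
filter-distinct-words A zero    = refl
filter-distinct-words A (suc m) =
  trans (filterᵇ-concatMap distinctᵇ _ A) (concatMap-cong fresh-head A)
  where
  fresh-head : ∀ a → filterᵇ distinctᵇ (map (a ∷_) (words A m)) ≡ map (a ∷_) (arrangements (removeℕ a A) m)
  fresh-head a = begin
    filterᵇ distinctᵇ (map (a ∷_) (words A m))
      ≡⟨ filterᵇ-map distinctᵇ (a ∷_) (words A m) ⟩
    map (a ∷_) (filterᵇ (λ w → not (memberᵇ a w) ∧ distinctᵇ w) (words A m))
      ≡⟨ cong (map (a ∷_)) (filterᵇ-∧ (not ∘ memberᵇ a) distinctᵇ (words A m)) ⟩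
    map (a ∷_) (filterᵇ distinctᵇ (filterᵇ (not ∘ memberᵇ a) (words A m)))
      ≡⟨ cong (map (a ∷_) ∘ filterᵇ distinctᵇ) (words-avoiding a A m) ⟩
    map (a ∷_) (filterᵇ distinctᵇ (words (removeℕ a A) m))
      ≡⟨ cong (map (a ∷_)) (filter-distinct-words (removeℕ a A) m) ⟩
    map (a ∷_) (arrangements (removeℕ a A) m) ∎
    where open ≡-Reasoning

perms≡arrangements : ∀ n → perms n ≡ arrangements (range n) n
perms≡arrangements n = trans (cong (filterᵇ distinctᵇ) (allWords≡words n n)) (filter-distinct-words (range n) n)

∑-arrangements-suc : ∀ A m (g : List ℕ → ℕ) →
  ∑ (arrangements A (suc m)) g ≡ ∑[ a ∈ A ] ∑[ w ∈ arrangements (removeℕ a A) m ] g (a ∷ w)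
∑-arrangements-suc A m g =
  trans (∑-concatMap _ A g) (∑-cong A λ a → ∑-map (a ∷_) (arrangements (removeℕ a A) m) g)

arrangements-length : ∀ A m → All (λ w → length w ≡ m) (arrangements A m)
arrangements-length A zero    = refl ∷ []
arrangements-length A (suc m) =
  All.concat⁺ (All.map⁺ (All.universal (λ a →
    All.map⁺ (All.map (cong suc) (arrangements-length (removeℕ a A) m))) A))

arrangements-All : ∀ {P : ℕ → Set} {A} m → All P A → All (All P) (arrangements A m)
arrangements-All zero    pA = [] ∷ []
arrangements-All {A = A} (suc m) pA =
  All.concat⁺ (All.map⁺ (All.map (λ {a} pa →
    All.map⁺ (All.map (pa ∷_) (arrangements-All m (All.filter⁺ (keep? a) pA)))) pA))

concatMap-[] : ∀ {h : A → List B} {xs} → All (λ x → h x ≡ []) xs → concatMap h xs ≡ []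
concatMap-[] []         = refl
concatMap-[] (eq ∷ eqs) rewrite eq = concatMap-[] eqs

arrangements-empty : ∀ A m → length A < m → arrangements A m ≡ []
arrangements-empty A (suc m) (s≤s |A|≤m) = concatMap-[] (All.tabulate λ {a} a∈A →
  cong (map (a ∷_)) (arrangements-empty (removeℕ a A) m (≤-trans (length-removeℕ-< {a} {A} a∈A) |A|≤m)))

insertAt : ℕ → A → List A → List A
insertAt j x w = take j w ++ x ∷ drop j w

-- An arrangement of x ∷ xs either contains x, at some position j, or is an arrangement of xs.
mutual
  ∑-arrangements-insert : ∀ {x xs} m (g : List ℕ → ℕ) → x ∉ xs →
    ∑ (arrangements (x ∷ xs) (suc m)) g
      ≡ ∑[ j < suc m ] ∑[ w ∈ arrangements xs m ] g (insertAt j x w) + ∑ (arrangements xs (suc m)) g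
  ∑-arrangements-insert {x} {xs} m g x∉xs = begin
    ∑ (arrangements (x ∷ xs) (suc m)) g
      ≡⟨ ∑-arrangements-suc (x ∷ xs) m g ⟩
    ∑[ w ∈ arrangements (removeℕ x (x ∷ xs)) m ] g (x ∷ w)
      + ∑[ a ∈ xs ] ∑[ w ∈ arrangements (removeℕ a (x ∷ xs)) m ] g (a ∷ w)
      ≡⟨ cong₂ _+_ (cong (λ A → ∑[ w ∈ arrangements A m ] g (x ∷ w)) (removeℕ-head x∉xs))
                   (∑-cong-local {xs = xs} (All.tabulate λ {a} a∈xs →
                     cong (λ A → ∑[ w ∈ arrangements A m ] g (a ∷ w))
                          (removeℕ-∷-≢ {a} {x} xs λ { refl → x∉xs a∈xs }))) ⟩
    ∑[ w ∈ arrangements xs m ] g (x ∷ w) + ∑[ a ∈ xs ] ∑[ w ∈ arrangements (x ∷ removeℕ a xs) m ] g (a ∷ w)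
      ≡⟨ cong (∑[ w ∈ arrangements xs m ] g (x ∷ w) +_) (∑-arrangements-insert-after-head m g x∉xs) ⟩
    ∑[ w ∈ arrangements xs m ] g (x ∷ w)
      + (∑[ j < m ] ∑[ w ∈ arrangements xs m ] g (insertAt (suc j) x w) + ∑ (arrangements xs (suc m)) g)
      ≡⟨ +-assoc (∑[ w ∈ arrangements xs m ] g (x ∷ w)) _ _ ⟨
    ∑[ j < suc m ] ∑[ w ∈ arrangements xs m ] g (insertAt j x w) + ∑ (arrangements xs (suc m)) g ∎
    where open ≡-Reasoning

  ∑-arrangements-insert-after-head : ∀ {x xs} m (g : List ℕ → ℕ) → x ∉ xs →
    ∑[ a ∈ xs ] ∑[ w ∈ arrangements (x ∷ removeℕ a xs) m ] g (a ∷ w)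
      ≡ ∑[ j < m ] ∑[ w ∈ arrangements xs m ] g (insertAt (suc j) x w) + ∑ (arrangements xs (suc m)) g
  ∑-arrangements-insert-after-head {x} {xs} zero g x∉xs = sym (∑-arrangements-suc xs 0 g)
  ∑-arrangements-insert-after-head {x} {xs} (suc m) g x∉xs = begin
    ∑[ a ∈ xs ] ∑[ w ∈ arrangements (x ∷ removeℕ a xs) (suc m) ] g (a ∷ w)
      ≡⟨ ∑-cong xs (λ a → ∑-arrangements-insert m (g ∘ (a ∷_)) (x∉xs ∘ ∈-removeℕ⁻ xs)) ⟩
    ∑[ a ∈ xs ] (∑[ j < suc m ] ∑[ w ∈ arrangements (removeℕ a xs) m ] g (a ∷ insertAt j x w)
                 + ∑[ w ∈ arrangements (removeℕ a xs) (suc m) ] g (a ∷ w))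
      ≡⟨ ∑-+ xs (λ a → ∑[ j < suc m ] ∑[ w ∈ arrangements (removeℕ a xs) m ] g (a ∷ insertAt j x w)) _ ⟩
    ∑[ a ∈ xs ] ∑[ j < suc m ] ∑[ w ∈ arrangements (removeℕ a xs) m ] g (a ∷ insertAt j x w)
      + ∑[ a ∈ xs ] ∑[ w ∈ arrangements (removeℕ a xs) (suc m) ] g (a ∷ w)
      ≡⟨ cong₂ _+_ (∑-∑<-comm xs (suc m) λ a j → ∑[ w ∈ arrangements (removeℕ a xs) m ] g (a ∷ insertAt j x w))
                   (sym (∑-arrangements-suc xs (suc m) g)) ⟩
    ∑[ j < suc m ] ∑[ a ∈ xs ] ∑[ w ∈ arrangements (removeℕ a xs) m ] g (insertAt (suc j) x (a ∷ w))
      + ∑ (arrangements xs (suc (suc m))) g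
      ≡⟨ cong (_+ ∑ (arrangements xs (suc (suc m))) g)
              (∑<-cong (suc m) λ j _ → sym (∑-arrangements-suc xs m (g ∘ insertAt (suc j) x))) ⟩
    ∑[ j < suc m ] ∑[ w ∈ arrangements xs (suc m) ] g (insertAt (suc j) x w) + ∑ (arrangements xs (suc (suc m))) g ∎
    where open ≡-Reasoning

length≡∑1 : ∀ (xs : List A) → length xs ≡ ∑[ x ∈ xs ] 1
length≡∑1 xs = sym (trans (∑-const xs 1) (*-identityʳ (length xs)))

length-arrangements : ∀ {A c} → AllPairs _<_ A → length A ≡ c → length (arrangements A c) ≡ c !
length-arrangements {[]}     []                refl = refl
length-arrangements {x ∷ xs} (x<xs ∷ xs-sorted) refl = begin
  length (arrangements (x ∷ xs) (suc c))
    ≡⟨ length≡∑1 (arrangements (x ∷ xs) (suc c)) ⟩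
  ∑[ w ∈ arrangements (x ∷ xs) (suc c) ] 1
    ≡⟨ ∑-arrangements-insert c (λ _ → 1) (All-<⇒∉ x<xs) ⟩
  ∑[ j < suc c ] ∑[ w ∈ arrangements xs c ] 1 + ∑[ w ∈ arrangements xs (suc c) ] 1
    ≡⟨ cong₂ _+_ (∑<-cong (suc c) λ _ _ →
                   trans (sym (length≡∑1 (arrangements xs c))) (length-arrangements xs-sorted refl))
                 (cong (λ W → ∑[ w ∈ W ] 1) (arrangements-empty xs (suc c) ≤-refl)) ⟩
  ∑[ j < suc c ] (c !) + 0
    ≡⟨ trans (+-identityʳ _) (∑<-const (suc c) (c !)) ⟩
  suc c ! ∎
  where
  open ≡-Reasoning
  c : ℕ
  c = length xs

-- Leftmost minima

-- On ties the left argument wins, as in argminσ.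
minBy : (ℕ → ℕ) → ℕ → ℕ → ℕ
minBy κ a b = if κ b <ᵇ κ a then b else a

<ᵇ-true : ∀ {m n} → m < n → (m <ᵇ n) ≡ true
<ᵇ-true {m} {n} m<n with m <ᵇ n | <ᵇ-reflects-< m n
... | true  | _         = refl
... | false | ofⁿ m≮n = ⊥-elim (m≮n m<n)

<ᵇ-false : ∀ {m n} → ¬ m < n → (m <ᵇ n) ≡ false
<ᵇ-false {m} {n} m≮n with m <ᵇ n | <ᵇ-reflects-< m n
... | true  | ofʸ m<n = ⊥-elim (m≮n m<n)
... | false | _        = refl

minBy-assoc : ∀ κ a b c → minBy κ (minBy κ a b) c ≡ minBy κ a (minBy κ b c)
minBy-assoc κ a b c with κ b <ᵇ κ a | <ᵇ-reflects-< (κ b) (κ a) | κ c <ᵇ κ b | <ᵇ-reflects-< (κ c) (κ b)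
... | true  | ofʸ b<a | true  | ofʸ c<b rewrite <ᵇ-true c<b | <ᵇ-true (<-trans c<b b<a) = refl
... | true  | ofʸ b<a | false | ofⁿ c≮b rewrite <ᵇ-false c≮b | <ᵇ-true b<a = refl
... | false | ofⁿ b≮a | true  | ofʸ c<b = refl
... | false | ofⁿ b≮a | false | ofⁿ c≮b
  rewrite <ᵇ-false (λ c<a → b≮a (≤-<-trans (≮⇒≥ c≮b) c<a)) | <ᵇ-false b≮a = refl

argminσ-step : ∀ σ x y ys → argminσ σ x (y ∷ ys) ≡ argminσ σ (minBy σ x y) ys
argminσ-step σ x y ys with σ y <ᵇ σ x
... | true  = refl
... | false = refl

argminσ-∷ : ∀ σ x y ys → argminσ σ x (y ∷ ys) ≡ minBy σ x (argminσ σ y ys)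
argminσ-∷ σ x y []       = refl
argminσ-∷ σ x y (z ∷ zs) = begin
  argminσ σ x (y ∷ z ∷ zs)               ≡⟨ argminσ-step σ x y (z ∷ zs) ⟩
  argminσ σ (minBy σ x y) (z ∷ zs)       ≡⟨ argminσ-∷ σ (minBy σ x y) z zs ⟩
  minBy σ (minBy σ x y) (argminσ σ z zs) ≡⟨ minBy-assoc σ x y (argminσ σ z zs) ⟩
  minBy σ x (minBy σ y (argminσ σ z zs)) ≡⟨ cong (minBy σ x) (argminσ-∷ σ y z zs) ⟨
  minBy σ x (argminσ σ y (z ∷ zs))       ∎
  where open ≡-Reasoning

record Split : Set where
  constructor _⟪_⟫_
  field
    before : List ℕ
    pivot  : ℕ
    after  : List ℕ
open Split

join : Split → List ℕ
join s = before s ++ pivot s ∷ after s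

_◂_ : ℕ → Split → Split
x ◂ s = (x ∷ before s) ⟪ pivot s ⟫ after s

mapSplit : (ℕ → ℕ) → Split → Split
mapSplit σ s = map σ (before s) ⟪ σ (pivot s) ⟫ map σ (after s)

pushMinBy : (ℕ → ℕ) → ℕ → Split → Split
pushMinBy κ x s = if κ (pivot s) <ᵇ κ x then x ◂ s else [] ⟪ x ⟫ join s

splitMinBy : (ℕ → ℕ) → ℕ → List ℕ → Split
splitMinBy κ x []       = [] ⟪ x ⟫ []
splitMinBy κ x (y ∷ ys) = pushMinBy κ x (splitMinBy κ y ys)

join-splitMinBy : ∀ κ x xs → join (splitMinBy κ x xs) ≡ x ∷ xs
join-splitMinBy κ x []       = refl
join-splitMinBy κ x (y ∷ ys) with κ (pivot (splitMinBy κ y ys)) <ᵇ κ x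
... | true  = cong (x ∷_) (join-splitMinBy κ y ys)
... | false = cong (x ∷_) (join-splitMinBy κ y ys)

pivot-splitMinBy : ∀ σ x xs → pivot (splitMinBy σ x xs) ≡ argminσ σ x xs
pivot-splitMinBy σ x []       = refl
pivot-splitMinBy σ x (y ∷ ys) = begin
  pivot (pushMinBy σ x (splitMinBy σ y ys)) ≡⟨ pivot-pushMinBy (splitMinBy σ y ys) ⟩
  minBy σ x (pivot (splitMinBy σ y ys))     ≡⟨ cong (minBy σ x) (pivot-splitMinBy σ y ys) ⟩
  minBy σ x (argminσ σ y ys)                ≡⟨ argminσ-∷ σ x y ys ⟨
  argminσ σ x (y ∷ ys)                      ∎
  where
  open ≡-Reasoning
  pivot-pushMinBy : ∀ s → pivot (pushMinBy σ x s) ≡ minBy σ x (pivot s)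
  pivot-pushMinBy s with σ (pivot s) <ᵇ σ x
  ... | true  = refl
  ... | false = refl

splitMinBy-map : ∀ σ x xs → splitMinBy id (σ x) (map σ xs) ≡ mapSplit σ (splitMinBy σ x xs)
splitMinBy-map σ x []       = refl
splitMinBy-map σ x (y ∷ ys) rewrite splitMinBy-map σ y ys with σ (pivot (splitMinBy σ y ys)) <ᵇ σ x
... | true  = refl
... | false = cong ([] ⟪ σ x ⟫_) (sym (map-++ σ (before s) (pivot s ∷ after s)))
  where
  s : Split
  s = splitMinBy σ y ys

pivot-∈ : ∀ κ x xs → pivot (splitMinBy κ x xs) ∈ x ∷ xs
pivot-∈ κ x xs =
  subst (pivot (splitMinBy κ x xs) ∈_) (join-splitMinBy κ x xs) (∈-++⁺ʳ (before (splitMinBy κ x xs)) (here refl))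

splitMinBy-leftmost : ∀ κ U {e V x xs} → x ∷ xs ≡ U ++ e ∷ V →
  All (λ u → κ e < κ u) U → All (λ v → κ e ≤ κ v) V → splitMinBy κ x xs ≡ U ⟪ e ⟫ V
splitMinBy-leftmost κ [] {V = []}    refl _ _ = refl
splitMinBy-leftmost κ [] {e} {v ∷ V} refl _ e≤V
  rewrite <ᵇ-false (≤⇒≯ (All.lookup e≤V (pivot-∈ κ v V))) = cong ([] ⟪ e ⟫_) (join-splitMinBy κ v V)
splitMinBy-leftmost κ (u ∷ U) {xs = []} eq _ _ = case ++-conicalʳ U _ (sym (∷-injectiveʳ eq)) of λ ()
splitMinBy-leftmost κ (u ∷ U) {e} {V} {xs = y ∷ ys} eq (e<u ∷ e<U) e≤V
  with refl ← ∷-injectiveˡ eq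
  rewrite splitMinBy-leftmost κ U (∷-injectiveʳ eq) e<U e≤V | <ᵇ-true e<u = refl

-- The counter on words

f1Pʷ-fuel : ℕ → List ℕ → ℕ
f1Pʷ-fuel _       []       = 0
f1Pʷ-fuel zero    (_ ∷ _)  = 0
f1Pʷ-fuel (suc k) (x ∷ xs) =
  let s = splitMinBy id x xs in f1Pʷ-fuel k (before s ++ after s) + 1 + f1Pʷ-fuel k (before s)

f1Pʷ : List ℕ → ℕ
f1Pʷ w = f1Pʷ-fuel (length w) w

length-splitMinBy : ∀ κ x xs → let s = splitMinBy κ x xs in length (before s ++ after s) ≡ length xs
length-splitMinBy κ x xs = suc-injective (begin
  suc (length (U ++ V))       ≡⟨ cong suc (length-++ U) ⟩
  suc (length U + length V)   ≡⟨ +-suc (length U) (length V) ⟨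
  length U + length (m ∷ V)   ≡⟨ length-++ U ⟨
  length (join s)             ≡⟨ cong length (join-splitMinBy κ x xs) ⟩
  suc (length xs)             ∎)
  where
  open ≡-Reasoning
  s : Split
  s = splitMinBy κ x xs
  U V : List ℕ
  U = before s
  V = after s
  m : ℕ
  m = pivot s

length-before-splitMinBy : ∀ κ x xs → length (before (splitMinBy κ x xs)) ≤ length xs
length-before-splitMinBy κ x xs = begin
  length U            ≤⟨ m≤m+n (length U) (length V) ⟩
  length U + length V ≡⟨ length-++ U ⟨
  length (U ++ V)     ≡⟨ length-splitMinBy κ x xs ⟩
  length xs           ∎
  where
  open ≤-Reasoning
  s : Split
  s = splitMinBy κ x xs
  U V : List ℕ
  U = before s
  V = after s

f1Pʷ-fuel-irrelevant : ∀ {k k'} w → length w ≤ k → length w ≤ k' → f1Pʷ-fuel k w ≡ f1Pʷ-fuel k' w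
f1Pʷ-fuel-irrelevant []       _         _          = refl
f1Pʷ-fuel-irrelevant {suc k} {suc k'} (x ∷ xs) (s≤s |xs|≤k) (s≤s |xs|≤k') =
  cong₂ (λ a b → a + 1 + b)
    (f1Pʷ-fuel-irrelevant (before s ++ after s)
       (subst (_≤ k) (sym |U++V|) |xs|≤k) (subst (_≤ k') (sym |U++V|) |xs|≤k'))
    (f1Pʷ-fuel-irrelevant (before s) (≤-trans |U| |xs|≤k) (≤-trans |U| |xs|≤k'))
  where
  s : Split
  s = splitMinBy id x xs
  |U++V| : length (before s ++ after s) ≡ length xs
  |U++V| = length-splitMinBy id x xs
  |U| : length (before s) ≤ length xs
  |U| = length-before-splitMinBy id x xs

f1Pʷ-fuel≡f1Pʷ : ∀ {k} w → length w ≤ k → f1Pʷ-fuel k w ≡ f1Pʷ w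
f1Pʷ-fuel≡f1Pʷ w |w|≤k = f1Pʷ-fuel-irrelevant w |w|≤k ≤-refl

f1Pʷ-∷ : ∀ x xs → let s = splitMinBy id x xs in f1Pʷ (x ∷ xs) ≡ f1Pʷ (before s ++ after s) + 1 + f1Pʷ (before s)
f1Pʷ-∷ x xs = cong₂ (λ a b → a + 1 + b)
  (f1Pʷ-fuel≡f1Pʷ (before s ++ after s) (≤-reflexive (length-splitMinBy id x xs)))
  (f1Pʷ-fuel≡f1Pʷ (before s) (length-before-splitMinBy id x xs))
  where
  s : Split
  s = splitMinBy id x xs

f1Pʷ-insert-min : ∀ U {e} V → All (e <_) U → All (e <_) V → f1Pʷ (U ++ e ∷ V) ≡ f1Pʷ (U ++ V) + 1 + f1Pʷ U
f1Pʷ-insert-min U {e} V e<U e<V with U ++ e ∷ V in eq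
... | []     = case ++-conicalʳ U (e ∷ V) eq of λ ()
... | x ∷ xs = trans (f1Pʷ-∷ x xs)
  (cong (λ s → f1Pʷ (before s ++ after s) + 1 + f1Pʷ (before s))
        (splitMinBy-leftmost id U (sym eq) e<U (All.map <⇒≤ e<V)))

f1P-fuel≡f1Pʷ-fuel : ∀ k N σ → AllPairs _<_ N → f1P-fuel k N σ ≡ f1Pʷ-fuel k (map σ N)
f1P-fuel≡f1Pʷ-fuel _       []       σ _      = refl
f1P-fuel≡f1Pʷ-fuel zero    (_ ∷ _)  σ _      = refl
f1P-fuel≡f1Pʷ-fuel (suc k) (x ∷ xs) σ sorted
  rewrite splitMinBy-map σ x xs | sym (pivot-splitMinBy σ x xs) =
  cong₂ (λ a b → a + 1 + b)
    (trans (recurse (keep? (pivot s)) removed) (cong (f1Pʷ-fuel k) (map-++ σ (before s) (after s))))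
    (recurse (below? (pivot s)) below)
  where
  s : Split
  s = splitMinBy σ x xs
  N≡ : x ∷ xs ≡ before s ++ pivot s ∷ after s
  N≡ = sym (join-splitMinBy σ x xs)
  around : All (_< pivot s) (before s) × All (pivot s <_) (after s)
  around = AllPairs-around (before s) (subst (AllPairs _<_) N≡ sorted)
  removed : removeℕ (pivot s) (x ∷ xs) ≡ before s ++ after s
  removed = trans (cong (removeℕ (pivot s)) N≡) (removeℕ-around (before s) (after s) (proj₁ around) (proj₂ around))
  below : belowℕ (pivot s) (x ∷ xs) ≡ before s
  below = trans (cong (belowℕ (pivot s)) N≡) (belowℕ-around (before s) (after s) (proj₁ around) (proj₂ around))
  recurse : ∀ {P : ℕ → Set} (P? : Decidable P) {M} → filter P? (x ∷ xs) ≡ M →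
            f1P-fuel k (filter P? (x ∷ xs)) σ ≡ f1Pʷ-fuel k (map σ M)
  recurse P? eq = trans (f1P-fuel≡f1Pʷ-fuel k _ σ (AllPairs.filter⁺ P? sorted)) (cong (f1Pʷ-fuel k ∘ map σ) eq)

f1P≡f1Pʷ : ∀ N σ → AllPairs _<_ N → f1P N σ ≡ f1Pʷ (map σ N)
f1P≡f1Pʷ N σ sorted =
  trans (f1P-fuel≡f1Pʷ-fuel (length N) N σ sorted) (f1Pʷ-fuel≡f1Pʷ (map σ N) (≤-reflexive (length-map σ N)))

f1Pʷ-insertAt-min : ∀ j {e} u → All (e <_) u → f1Pʷ (insertAt j e u) ≡ f1Pʷ u + 1 + f1Pʷ (take j u)
f1Pʷ-insertAt-min j u e<u =
  trans (f1Pʷ-insert-min (take j u) (drop j u) (All.take⁺ j e<u) (All.drop⁺ j e<u))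
        (cong (λ w → f1Pʷ w + 1 + f1Pʷ (take j u)) (take++drop≡id j u))

take-insertAt-≤ : ∀ {j k} (e : A) w → j ≤ k → take (suc k) (insertAt j e w) ≡ insertAt j e (take k w)
take-insertAt-≤ {j = zero}           e w       _         = refl
take-insertAt-≤ {j = suc j} {suc k} e []      _         = refl
take-insertAt-≤ {j = suc j} {suc k} e (a ∷ w) (s≤s j≤k) = cong (a ∷_) (take-insertAt-≤ e w j≤k)

take-insertAt-≥ : ∀ {j k} (e : A) w → k ≤ j → k ≤ length w → take k (insertAt j e w) ≡ take k w
take-insertAt-≥ {k = zero}          e w       _         _         = refl
take-insertAt-≥ {j = suc j} {suc k} e (a ∷ w) (s≤s k≤j) (s≤s k≤|w|) =
  cong (a ∷_) (take-insertAt-≥ e w k≤j k≤|w|)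

f1Pʷ-take-insertAt-≤ : ∀ {j k e} w → All (e <_) w → j ≤ k →
  f1Pʷ (take (suc k) (insertAt j e w)) ≡ f1Pʷ (take k w) + 1 + f1Pʷ (take j w)
f1Pʷ-take-insertAt-≤ {j} {k} {e} w e<w j≤k = begin
  f1Pʷ (take (suc k) (insertAt j e w))                ≡⟨ cong f1Pʷ (take-insertAt-≤ e w j≤k) ⟩
  f1Pʷ (insertAt j e (take k w))                      ≡⟨ f1Pʷ-insertAt-min j (take k w) (All.take⁺ k e<w) ⟩
  f1Pʷ (take k w) + 1 + f1Pʷ (take j (take k w))      ≡⟨ cong (λ v → f1Pʷ (take k w) + 1 + f1Pʷ v) take-take-≤ ⟩
  f1Pʷ (take k w) + 1 + f1Pʷ (take j w)               ∎
  where
  open ≡-Reasoning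
  take-take-≤ : take j (take k w) ≡ take j w
  take-take-≤ = trans (take-take j k w) (cong (λ n → take n w) (m≤n⇒m⊓n≡m j≤k))

-- Prefix totals

prefixTotal : List ℕ → ℕ → ℕ → ℕ
prefixTotal A c k = ∑[ w ∈ arrangements A c ] f1Pʷ (take k w)

prefixTotal-suc : ∀ {x xs k} → AllPairs _<_ (x ∷ xs) → k ≤ length xs →
  let c = length xs in
  prefixTotal (x ∷ xs) (suc c) (suc k)
    ≡ suc k * (prefixTotal xs c k + c !) + ∑[ j < suc k ] prefixTotal xs c j + (c ∸ k) * prefixTotal xs c (suc k)
prefixTotal-suc {x} {xs} {k} (x<xs ∷ sorted) k≤c = begin
  prefixTotal (x ∷ xs) (suc c) (suc k)
    ≡⟨ ∑-arrangements-insert c (f1Pʷ ∘ take (suc k)) (All-<⇒∉ x<xs) ⟩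
  ∑< (suc c) g + ∑ (arrangements xs (suc c)) (f1Pʷ ∘ take (suc k))
    ≡⟨ cong (λ W → ∑< (suc c) g + ∑ W (f1Pʷ ∘ take (suc k))) (arrangements-empty xs (suc c) ≤-refl) ⟩
  ∑< (suc c) g + 0
    ≡⟨ trans (+-identityʳ _) (cong (λ n → ∑< (suc n) g) (sym (m+[n∸m]≡n k≤c))) ⟩
  ∑< (suc k + (c ∸ k)) g
    ≡⟨ ∑<-split (suc k) (c ∸ k) g ⟩
  ∑< (suc k) g + ∑[ j < c ∸ k ] g (suc k + j)
    ≡⟨ cong₂ _+_ (∑<-cong (suc k) λ j j<1+k → inserted-before j (≤-pred j<1+k))
                 (∑<-cong (c ∸ k) λ j j<c∸k → inserted-after j (k<c j<c∸k)) ⟩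
  ∑[ j < suc k ] (prefixTotal xs c k + c ! + prefixTotal xs c j) + ∑[ j < c ∸ k ] prefixTotal xs c (suc k)
    ≡⟨ cong₂ _+_ (trans (∑<-+ (suc k) (λ _ → prefixTotal xs c k + c !) (prefixTotal xs c))
                        (cong (_+ ∑< (suc k) (prefixTotal xs c)) (∑<-const (suc k) (prefixTotal xs c k + c !))))
                 (∑<-const (c ∸ k) (prefixTotal xs c (suc k))) ⟩
  suc k * (prefixTotal xs c k + c !) + ∑[ j < suc k ] prefixTotal xs c j + (c ∸ k) * prefixTotal xs c (suc k) ∎
  where
  open ≡-Reasoning
  c : ℕ
  c = length xs
  g : ℕ → ℕ
  g j = ∑[ w ∈ arrangements xs c ] f1Pʷ (take (suc k) (insertAt j x w))
  arranged : All (λ w → All (x <_) w × length w ≡ c) (arrangements xs c)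
  arranged = All.zip (arrangements-All c x<xs , arrangements-length xs c)
  k<c : ∀ {j} → j < c ∸ k → k < c
  k<c {j} j<c∸k = m∸n≢0⇒n<m λ c∸k≡0 → case subst (j <_) c∸k≡0 j<c∸k of λ ()
  inserted-before : ∀ j → j ≤ k → g j ≡ prefixTotal xs c k + c ! + prefixTotal xs c j
  inserted-before j j≤k = begin
    g j
      ≡⟨ ∑-cong-local (All.map (λ {w} (x<w , _) → f1Pʷ-take-insertAt-≤ w x<w j≤k) arranged) ⟩
    ∑[ w ∈ arrangements xs c ] (f1Pʷ (take k w) + 1 + f1Pʷ (take j w))
      ≡⟨ ∑-+ (arrangements xs c) (λ w → f1Pʷ (take k w) + 1) (λ w → f1Pʷ (take j w)) ⟩
    ∑[ w ∈ arrangements xs c ] (f1Pʷ (take k w) + 1) + prefixTotal xs c j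
      ≡⟨ cong (_+ prefixTotal xs c j) (∑-+ (arrangements xs c) (λ w → f1Pʷ (take k w)) (λ _ → 1)) ⟩
    prefixTotal xs c k + ∑[ w ∈ arrangements xs c ] 1 + prefixTotal xs c j
      ≡⟨ cong (λ n → prefixTotal xs c k + n + prefixTotal xs c j)
              (trans (sym (length≡∑1 (arrangements xs c))) (length-arrangements sorted refl)) ⟩
    prefixTotal xs c k + c ! + prefixTotal xs c j ∎
  inserted-after : ∀ j → k < c → g (suc k + j) ≡ prefixTotal xs c (suc k)
  inserted-after j k<c = ∑-cong-local (All.map (λ {w} (_ , |w|≡c) →
    cong f1Pʷ (take-insertAt-≥ x w (m≤m+n (suc k) j) (subst (suc k ≤_) (sym |w|≡c) k<c))) arranged)

toℚ-mkℚ : ∀ n → toℚ n ≡ mkℚ (ℤ.+ n) 0 (Coprime.sym (1-coprimeTo n))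
toℚ-mkℚ n = normalize-coprime (Coprime.sym (1-coprimeTo n))

toℚ-+ : ∀ m n → toℚ (m + n) ≡ toℚ m +ℚ toℚ n
toℚ-+ m n rewrite toℚ-mkℚ m | toℚ-mkℚ n =
  sym (/-cong {p₂ = ℤ.+ (m + n)} (cong₂ ℤ._+_ (ℤ.*-identityʳ (ℤ.+ m)) (ℤ.*-identityʳ (ℤ.+ n))) refl)

toℚ-* : ∀ m n → toℚ (m * n) ≡ toℚ m *ℚ toℚ n
toℚ-* m n rewrite toℚ-mkℚ m | toℚ-mkℚ n = sym (/-cong {p₂ = ℤ.+ (m * n)} (sym (ℤ.pos-* m n)) refl)

1/suc*toℚ-suc : ∀ k → (ℤ.+ 1 / suc k) *ℚ toℚ (suc k) ≡ 1ℚ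
1/suc*toℚ-suc k rewrite toℚ-mkℚ (suc k) | normalize-coprime {1} {k} (1-coprimeTo (suc k)) =
  ℚ.*-inverseˡ (mkℚ (ℤ.+ suc k) 0 (Coprime.sym (1-coprimeTo (suc k))))

f-suc-scaled : ∀ k → toℚ (suc k) *ℚ f (suc k) ≡ toℚ (suc k) *ℚ (f k +ℚ 1ℚ) +ℚ sumℚ (fs (suc k))
f-suc-scaled k = begin
  K *ℚ (f k +ℚ 1ℚ +ℚ r *ℚ Σ)           ≡⟨ ℚ.*-distribˡ-+ K (f k +ℚ 1ℚ) (r *ℚ Σ) ⟩
  K *ℚ (f k +ℚ 1ℚ) +ℚ K *ℚ (r *ℚ Σ)    ≡⟨ cong (K *ℚ (f k +ℚ 1ℚ) +ℚ_) K[rΣ]≡Σ ⟩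
  K *ℚ (f k +ℚ 1ℚ) +ℚ Σ                ∎
  where
  open ≡-Reasoning
  K r Σ : ℚ
  K = toℚ (suc k)
  r = ℤ.+ 1 / suc k
  Σ = sumℚ (fs (suc k))
  K[rΣ]≡Σ : K *ℚ (r *ℚ Σ) ≡ Σ
  K[rΣ]≡Σ = begin
    K *ℚ (r *ℚ Σ)  ≡⟨ ℚ.*-assoc K r Σ ⟨
    (K *ℚ r) *ℚ Σ  ≡⟨ cong (_*ℚ Σ) (trans (ℚ.*-comm K r) (1/suc*toℚ-suc k)) ⟩
    1ℚ *ℚ Σ        ≡⟨ ℚ.*-identityˡ Σ ⟩
    Σ              ∎

toℚ-∑<-fs : ∀ n (g : ℕ → ℕ) q → (∀ j → j < n → toℚ (g j) ≡ f j *ℚ q) →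
  toℚ (∑< n g) ≡ sumℚ (fs n) *ℚ q
toℚ-∑<-fs zero    g q _    = sym (ℚ.*-zeroˡ q)
toℚ-∑<-fs (suc n) g q g≡fq = begin
  toℚ (∑< (suc n) g)                   ≡⟨ cong toℚ (∑<-suc n g) ⟩
  toℚ (∑< n g + g n)                   ≡⟨ toℚ-+ (∑< n g) (g n) ⟩
  toℚ (∑< n g) +ℚ toℚ (g n)            ≡⟨ cong₂ _+ℚ_ (toℚ-∑<-fs n g q λ j j<n → g≡fq j (m<n⇒m<1+n j<n))
                                                     (g≡fq n ≤-refl) ⟩
  sumℚ (fs n) *ℚ q +ℚ f n *ℚ q         ≡⟨ ℚ.+-comm (sumℚ (fs n) *ℚ q) (f n *ℚ q) ⟩
  f n *ℚ q +ℚ sumℚ (fs n) *ℚ q         ≡⟨ ℚ.*-distribʳ-+ q (f n) (sumℚ (fs n)) ⟨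
  sumℚ (fs (suc n)) *ℚ q               ∎
  where open ≡-Reasoning

toℚ-prefixTotal : ∀ {A c k} → AllPairs _<_ A → length A ≡ c → k ≤ c →
  toℚ (prefixTotal A c k) ≡ f k *ℚ toℚ (c !)
toℚ-prefixTotal {A} {c} {zero} _ _ _ =
  trans (cong toℚ (trans (∑-const (arrangements A c) 0) (*-zeroʳ (length (arrangements A c)))))
        (sym (ℚ.*-zeroˡ (toℚ (c !))))
toℚ-prefixTotal {x ∷ xs} {k = suc k} sorted@(_ ∷ xs-sorted) refl (s≤s k≤c) = begin
  toℚ (prefixTotal (x ∷ xs) (suc c) (suc k))
    ≡⟨ cong toℚ (prefixTotal-suc sorted k≤c) ⟩
  toℚ (suc k * (S k + c !) + ∑< (suc k) S + (c ∸ k) * S (suc k))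
    ≡⟨ trans (toℚ-+ (suc k * (S k + c !) + ∑< (suc k) S) ((c ∸ k) * S (suc k)))
             (cong (_+ℚ toℚ ((c ∸ k) * S (suc k))) (toℚ-+ (suc k * (S k + c !)) (∑< (suc k) S))) ⟩
  toℚ (suc k * (S k + c !)) +ℚ toℚ (∑< (suc k) S) +ℚ toℚ ((c ∸ k) * S (suc k))
    ≡⟨ cong₂ _+ℚ_ (cong₂ _+ℚ_ scaled-head summed) scaled-tail ⟩
  K *ℚ (f k *ℚ X +ℚ X) +ℚ sumℚ (fs (suc k)) *ℚ X +ℚ D *ℚ (f (suc k) *ℚ X)
    ≡⟨ solve 5 (λ K A Σ X R → K :* (A :* X :+ X) :+ Σ :* X :+ R := (K :* (A :+ con 1ℚ) :+ Σ) :* X :+ R)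
             refl K (f k) (sumℚ (fs (suc k))) X (D *ℚ (f (suc k) *ℚ X)) ⟩
  (K *ℚ (f k +ℚ 1ℚ) +ℚ sumℚ (fs (suc k))) *ℚ X +ℚ D *ℚ (f (suc k) *ℚ X)
    ≡⟨ cong (λ q → q *ℚ X +ℚ D *ℚ (f (suc k) *ℚ X)) (f-suc-scaled k) ⟨
  (K *ℚ f (suc k)) *ℚ X +ℚ D *ℚ (f (suc k) *ℚ X)
    ≡⟨ solve 4 (λ K B X D → (K :* B) :* X :+ D :* (B :* X) := B :* ((K :+ D) :* X)) refl K (f (suc k)) X D ⟩
  f (suc k) *ℚ ((K +ℚ D) *ℚ X)
    ≡⟨ cong (f (suc k) *ℚ_) (trans (cong (_*ℚ X) (sym (toℚ-+ (suc k) (c ∸ k))))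
                                   (trans (cong (λ n → toℚ (suc n) *ℚ X) (m+[n∸m]≡n k≤c))
                                          (sym (toℚ-* (suc c) (c !))))) ⟩
  f (suc k) *ℚ toℚ (suc c !) ∎
  where
  open ≡-Reasoning
  open +-*-Solver
  c : ℕ
  c = length xs
  S : ℕ → ℕ
  S = prefixTotal xs c
  K X D : ℚ
  K = toℚ (suc k)
  X = toℚ (c !)
  D = toℚ (c ∸ k)
  induction : ∀ {j} → j ≤ c → toℚ (S j) ≡ f j *ℚ X
  induction = toℚ-prefixTotal xs-sorted refl
  scaled-head : toℚ (suc k * (S k + c !)) ≡ K *ℚ (f k *ℚ X +ℚ X)
  scaled-head = trans (toℚ-* (suc k) (S k + c !))
                      (cong (K *ℚ_) (trans (toℚ-+ (S k) (c !)) (cong (_+ℚ X) (induction k≤c))))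
  summed : toℚ (∑< (suc k) S) ≡ sumℚ (fs (suc k)) *ℚ X
  summed = toℚ-∑<-fs (suc k) S X λ j j<1+k → induction (≤-trans (≤-pred j<1+k) k≤c)
  scaled-tail : toℚ ((c ∸ k) * S (suc k)) ≡ D *ℚ (f (suc k) *ℚ X)
  scaled-tail with m≤n⇒m<n∨m≡n k≤c
  ... | inj₁ k<c  = trans (toℚ-* (c ∸ k) (S (suc k))) (cong (D *ℚ_) (induction k<c))
  ... | inj₂ refl rewrite n∸n≡0 k = sym (ℚ.*-zeroˡ (f (suc k) *ℚ X))

range-sorted : ∀ n → AllPairs _<_ (range n)
range-sorted n = AllPairs.map⁺ (AllPairs.applyUpTo⁺₁ id n λ i<j _ → s≤s i<j)

length-range : ∀ n → length (range n) ≡ n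
length-range n = trans (length-map suc (upTo n)) (length-upTo n)

applyUpTo-nth : ∀ w → applyUpTo (nth w) (length w) ≡ w
applyUpTo-nth []      = refl
applyUpTo-nth (x ∷ w) = cong (x ∷_) (applyUpTo-nth w)

map-asMap-range : ∀ w → map (asMap w) (range (length w)) ≡ w
map-asMap-range w = begin
  map (asMap w) (map suc (upTo (length w)))  ≡⟨ map-∘ (upTo (length w)) ⟨
  map (nth w) (upTo (length w))              ≡⟨ map-upTo (nth w) (length w) ⟩
  applyUpTo (nth w) (length w)               ≡⟨ applyUpTo-nth w ⟩
  w                                          ∎
  where open ≡-Reasoning

totalf1P≡prefixTotal : ∀ n → totalf1P n ≡ prefixTotal (range n) n n
totalf1P≡prefixTotal n = begin
  ∑[ w ∈ perms n ] f1P (range n) (asMap w)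
    ≡⟨ cong (λ W → ∑[ w ∈ W ] f1P (range n) (asMap w)) (perms≡arrangements n) ⟩
  ∑[ w ∈ arrangements (range n) n ] f1P (range n) (asMap w)
    ≡⟨ ∑-cong-local (All.map as-word (arrangements-length (range n) n)) ⟩
  prefixTotal (range n) n n ∎
  where
  open ≡-Reasoning
  as-word : ∀ {w} → length w ≡ n → f1P (range n) (asMap w) ≡ f1Pʷ (take n w)
  as-word {w} refl = begin
    f1P (range n) (asMap w)         ≡⟨ f1P≡f1Pʷ (range n) (asMap w) (range-sorted n) ⟩
    f1Pʷ (map (asMap w) (range n)) ≡⟨ cong f1Pʷ (map-asMap-range w) ⟩
    f1Pʷ w                          ≡⟨ cong f1Pʷ (take-all n w ≤-refl) ⟨
    f1Pʷ (take n w)                 ∎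

length-perms : ∀ n → length (perms n) ≡ n !
length-perms n = trans (cong length (perms≡arrangements n)) (length-arrangements (range-sorted n) (length-range n))

mainTheorem5 : (n : ℕ) → f n *ℚ toℚ (length (perms n)) ≡ toℚ (totalf1P n)
mainTheorem5 n = begin
  f n *ℚ toℚ (length (perms n))    ≡⟨ cong (λ m → f n *ℚ toℚ m) (length-perms n) ⟩
  f n *ℚ toℚ (n !)                  ≡⟨ toℚ-prefixTotal (range-sorted n) (length-range n) ≤-refl ⟨
  toℚ (prefixTotal (range n) n n)  ≡⟨ cong toℚ (totalf1P≡prefixTotal n) ⟨
  toℚ (totalf1P n)                  ∎
  where open ≡-Reasoning
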